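{- Let $F:\mathbb{Z}^2\to\mathbb{Z}$ be superharmonic. Then for all $n\in\mathbb{N}$, $|S_n(F)-S_{n+1}(F)|\le1$ at every point of $\mathbb{Z}^2$.
   Context: The discrete Laplacian is $\Delta F(x,y)=-4F(x,y)+F(x+1,y)+F(x-1,y)+F(x,y+1)+F(x,y-1)$. The function $F$ is superharmonic if $\Delta F\le0$. The deviation set is $D(F)=\{v:\Delta F(v)\ne0\}$. $B_C(A)$ is the set of points at distance at most $C$ from $A$. $\Theta_n(F)$ is the set of all $G:\mathbb{Z}^2\to\mathbb{Z}$ such that: - $\Delta G\le0$; - $F-n\le G\le F$; - $\{F\ne G\}\subset B_C(D(F))$ for some $C>0$. $S_n(F)(v)=\min\{G(v):G\in\Theta_n(F)\}$ is the $n$-smoothing of $F$. -}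

module Defs where

open import Data.Nat using (ℕ) renaming (_≤_ to _≤ℕ_; _<_ to _<ℕ_)
open import Data.Integer using (ℤ; +_; _+_; _-_; _*_; -_; ∣_∣; _≤_; 0ℤ; 1ℤ)
open import Data.Product using (Σ; _×_; _,_; ∃)
open import Relation.Binary.PropositionalEquality using (_≢_)

Point : Set
Point = ℤ × ℤ

Δ : (Point → ℤ) → Point → ℤ
Δ F (x , y) =
  - (+ 4 * F (x , y)) + F (x + 1ℤ , y) + F (x - 1ℤ , y)
    + F (x , y + 1ℤ) + F (x , y - 1ℤ)

Superharmonic : (Point → ℤ) → Set
Superharmonic F = ∀ v → Δ F v ≤ 0ℤ

InD : (Point → ℤ) → Point → Set
InD F v = Δ F v ≢ 0ℤ

dist : Point → Point → ℕ
dist (x₁ , y₁) (x₂ , y₂) = ∣ x₁ - x₂ ∣ Data.Nat.+ ∣ y₁ - y₂ ∣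

InBall : ℕ → (Point → Set) → Point → Set
InBall C A v = Σ Point λ w → A w × dist v w ≤ℕ C

InΘ : ℕ → (Point → ℤ) → (Point → ℤ) → Set
InΘ n F G =
  (∀ v → Δ G v ≤ 0ℤ)
  × (∀ v → F v - + n ≤ G v)
  × (∀ v → G v ≤ F v)
  × Σ ℕ (λ C → (0 <ℕ C) × (∀ v → F v ≢ G v → InBall C (InD F) v))

-- m = S_n(F)(v), i.e. m is the minimum of {G(v) : G ∈ Θ_n(F)}
IsSmoothingValue : ℕ → (Point → ℤ) → Point → ℤ → Set
IsSmoothingValue n F v m =
  Σ (Point → ℤ) (λ G → InΘ n F G × G v Relation.Binary.PropositionalEquality.≡ m)
  × (∀ G → InΘ n F G → m ≤ G v)

module Submission where

-- Write Θₙ for Θₙ(F).  Because the lower bound F - n ≤ G only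
-- weakens as n grows, Θₙ ⊆ Θₙ₊₁, so minimising over the larger class gives
-- Sₙ₊₁(F) ≤ Sₙ(F).  Conversely, if G ∈ Θₙ₊₁ then the truncation F ⊓ (G + 1)
-- lies in Θₙ: it is a minimum of two superharmonic functions (F, and G
-- shifted by a constant), it is squeezed between F - n and F, and it differs
-- from F only where G does.  Hence Sₙ(F) ≤ Sₙ₊₁(F) + 1, and the two
-- inequalities together give |Sₙ(F) - Sₙ₊₁(F)| ≤ 1.

open import Defs
open import Data.Nat using (ℕ; suc) renaming (_≤_ to _≤ℕ_; _+_ to _+ℕ_)
import Data.Nat.Properties as ℕ
open import Data.Integer
  using (ℤ; ∣_∣; _-_; _+_; _*_; -_; +_; _≤_; _⊓_; 1ℤ; _≤?_; +≤+)
open import Data.Integer.Properties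
open import Data.Integer.Tactic.RingSolver using (solve-∀)
open import Data.Product using (_,_)
open import Relation.Binary.PropositionalEquality
open import Relation.Nullary using (yes; no)

-- If H ≤ K everywhere and H touches K at p, then Δ H p ≤ Δ K p: the centre
-- terms agree and each neighbour term of H is at most that of K.
Δ-touching-below : ∀ (H K : Point → ℤ) p →
  (∀ w → H w ≤ K w) → H p ≡ K p → Δ H p ≤ Δ K p
Δ-touching-below H K (x , y) H≤K Hp≡Kp rewrite Hp≡Kp =
  +-mono-≤ (+-mono-≤ (+-mono-≤ (+-mono-≤ (≤-refl { - (+ 4 * K (x , y))})
    (H≤K (x + 1ℤ , y))) (H≤K (x - 1ℤ , y))) (H≤K (x , y + 1ℤ))) (H≤K (x , y - 1ℤ))

Δ-shift : ∀ (G : Point → ℤ) (c : ℤ) p → Δ (λ w → G w + c) p ≡ Δ G p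
Δ-shift G c (x , y) =
  stencil c (G (x , y)) (G (x + 1ℤ , y)) (G (x - 1ℤ , y))
            (G (x , y + 1ℤ)) (G (x , y - 1ℤ))
  where
  stencil : ∀ c g₀ g₁ g₂ g₃ g₄ →
    - (+ 4 * (g₀ + c)) + (g₁ + c) + (g₂ + c) + (g₃ + c) + (g₄ + c)
      ≡ - (+ 4 * g₀) + g₁ + g₂ + g₃ + g₄
  stencil = solve-∀

-- The pointwise minimum of two superharmonic functions is superharmonic: at
-- each point the minimum touches one of them from below.
superharmonic-⊓ : ∀ (H K : Point → ℤ) →
  Superharmonic H → Superharmonic K → Superharmonic (λ w → H w ⊓ K w)
superharmonic-⊓ H K ΔH≤0 ΔK≤0 p with H p ≤? K p
... | yes Hp≤Kp = ≤-trans
  (Δ-touching-below _ H p (λ w → i⊓j≤i (H w) (K w)) (i≤j⇒i⊓j≡i Hp≤Kp)) (ΔH≤0 p)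
... | no Hp≰Kp = ≤-trans
  (Δ-touching-below _ K p (λ w → i⊓j≤j (H w) (K w)) (i≥j⇒i⊓j≡j (<⇒≤ (≰⇒> Hp≰Kp))))
  (ΔK≤0 p)

-- Θₙ(F) ⊆ Θₘ(F) for n ≤ m: only the lower bound depends on n, and it weakens.
InΘ-mono : ∀ {n m} F G → n ≤ℕ m → InΘ n F G → InΘ m F G
InΘ-mono F G n≤m (ΔG≤0 , lower , upper , deviation) =
  ΔG≤0
  , (λ w → ≤-trans (+-monoʳ-≤ (F w) (neg-mono-≤ (+≤+ n≤m))) (lower w))
  , upper
  , deviation

lower-bound-shift : ∀ f g k n → f - + (k +ℕ n) ≤ g → f - + n ≤ g + + k
lower-bound-shift f g k n f-k-n≤g =
  subst (_≤ g + + k) cancel (+-monoˡ-≤ (+ k) f-k-n≤g)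
  where
  cancel : f - + (k +ℕ n) + + k ≡ f - + n
  cancel rewrite pos-+ k n = rearrange f (+ k) (+ n)
    where
    rearrange : ∀ f k n → f - (k + n) + k ≡ f - n
    rearrange = solve-∀

truncate : (F G : Point → ℤ) → ℕ → Point → ℤ
truncate F G k w = F w ⊓ (G w + + k)

truncate-InΘ : ∀ F G k n → Superharmonic F →
  InΘ (k +ℕ n) F G → InΘ n F (truncate F G k)
truncate-InΘ F G k n ΔF≤0 (ΔG≤0 , lower , upper , (C , 0<C , deviation)) =
  superharmonic-⊓ F (λ w → G w + + k) ΔF≤0 shifted-superharmonic
  , (λ w → ⊓-glb (i-j≤i (F w) (+ n)) (lower-bound-shift (F w) (G w) k n (lower w)))
  , (λ w → i⊓j≤i (F w) (G w + + k))
  , (C , 0<C , λ w F≢T → deviation w (λ F≡G → F≢T (untouched w F≡G)))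
  where
  shifted-superharmonic : Superharmonic (λ w → G w + + k)
  shifted-superharmonic p rewrite Δ-shift G (+ k) p = ΔG≤0 p

  -- Where G agrees with F, so does the truncation (as k ≥ 0).
  untouched : ∀ w → F w ≡ G w → F w ≡ truncate F G k w
  untouched w F≡G =
    sym (i≤j⇒i⊓j≡i (subst (λ g → F w ≤ g + + k) F≡G (i≤i+j (F w) (+ k))))

dist≤1 : ∀ a b → b ≤ a → a ≤ b + 1ℤ → ∣ a - b ∣ ≤ℕ 1
dist≤1 a b b≤a a≤b+1 = drop‿+≤+ (begin
  + ∣ a - b ∣  ≡⟨ 0≤i⇒+∣i∣≡i (i≤j⇒0≤j-i b≤a) ⟩
  a - b        ≤⟨ +-monoˡ-≤ (- b) a≤b+1 ⟩
  b + 1ℤ - b   ≡⟨ cancel b ⟩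
  1ℤ           ∎)
  where
  open ≤-Reasoning
  cancel : ∀ b → b + 1ℤ - b ≡ 1ℤ
  cancel = solve-∀

proposition4p3 : (F : Point → ℤ) → Superharmonic F →
    (n : ℕ) → (v : Point) → (a b : ℤ) →
    IsSmoothingValue n F v a → IsSmoothingValue (suc n) F v b →
    ∣ a - b ∣ ≤ℕ 1
proposition4p3 F ΔF≤0 n v a b ((Gₐ , Gₐ∈Θₙ , Gₐv≡a) , a-minimal)
                              ((G_b , G_b∈Θₙ₊₁ , G_bv≡b) , b-minimal) =
  dist≤1 a b b≤a a≤b+1
  where
  b≤a : b ≤ a
  b≤a = subst (b ≤_) Gₐv≡a (b-minimal Gₐ (InΘ-mono F Gₐ (ℕ.n≤1+n n) Gₐ∈Θₙ))

  a≤b+1 : a ≤ b + 1ℤ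
  a≤b+1 = subst (λ g → a ≤ g + 1ℤ) G_bv≡b
    (≤-trans (a-minimal (truncate F G_b 1) (truncate-InΘ F G_b 1 n ΔF≤0 G_b∈Θₙ₊₁))
             (i⊓j≤j (F v) (G_b v + 1ℤ)))
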